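{- Let $0\le k\le d$. Then $\Diamond(\Gamma_k)\cong\bigcup_{i=k+1}^{d+1}\Diamond(\Gamma_i)$ (isomorphism of simplicial complexes).
   Context: $\sigma^{d+1}$ is the simplex on $\{0,\dots,d+1\}$ and $\Gamma_i=\{0,\dots,d+1\}\setminus\{i\}$, viewed as the $d$-simplex $\langle\Gamma_i\rangle\subseteq\partial\sigma^{d+1}$. For a pure $d$-dimensional subcomplex $\Gamma\subseteq\partial\sigma^{d+1}$, $\Diamond(\Gamma)$ is obtained by, for $i=0,1,\dots,d$ in this order, stellarly subdividing the current complex $K$ at $F_i=\{i+1,\dots,d+1\}$ whenever $F_i\in K$, i.e. replacing $K$ by $(K\setminus F_i)\cup(\langle v_i\rangle*\partial F_i*\mathrm{lk}_K(F_i))$ with new vertex $v_i$ (where $K\setminus F=\{G\in K:F\not\subseteq G\}$ and $\partial F$ is the complex of proper subsets of $F$). The result lies in the boundary of the cross-polytope on $\{0,\dots,d\}\cup\{v_0,\dots,v_d\}$. -}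

module Defs where

open import Data.Nat using (ℕ; suc; _+_; _<ᵇ_)
open import Data.Bool using (Bool; true; false; not)
open import Data.Fin using (Fin; toℕ; splitAt; _↑ʳ_)
open import Data.Fin.Subset using (Subset; _⊆_; _∪_; _∩_; ⁅_⁆; ⊥)
open import Data.Fin.Permutation using (Permutation′; _⟨$⟩ˡ_)
open import Data.Vec using (tabulate; lookup)
open import Data.List using (foldl; allFin)
open import Data.Sum using (_⊎_; [_,_])
open import Data.Product using (Σ; _×_; ∃₂)
open import Relation.Nullary using (¬_)
open import Relation.Binary.PropositionalEquality using (_≡_)
open import Level using (0ℓ)

-- Ambient vertex set for dimension d: Fin (N d) = Fin (d+2) ⊎ Fin (d+1), via splitAt (d+2).
--   original vertex i ∈ {0,…,d+1}  ↦  i ↑ˡ (d+1)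
--   new vertex v_i, i ∈ {0,…,d}    ↦  (d+2) ↑ʳ i
N : ℕ → ℕ
N d = suc (suc d) + suc d

Complex : ℕ → Set₁
Complex n = Subset n → Set

vNew : (d : ℕ) → Fin (suc d) → Fin (N d)
vNew d i = suc (suc d) ↑ʳ i

-- F_i = {i+1, …, d+1}  (original vertices)
F : (d : ℕ) → Fin (suc d) → Subset (N d)
F d i = tabulate (λ x → [ (λ j → toℕ i <ᵇ toℕ j) , (λ _ → false) ] (splitAt (suc (suc d)) x))

-- vertex set Γ_i = {0,…,d+1} ∖ {i}
Γset : (d : ℕ) → Fin (suc (suc d)) → Subset (N d)
Γset d i = tabulate (λ x → [ (λ j → not (toℕ j Data.Nat.≡ᵇ toℕ i)) , (λ _ → false) ] (splitAt (suc (suc d)) x))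

Γ : (d : ℕ) → Fin (suc (suc d)) → Complex (N d)
Γ d i σ = σ ⊆ Γset d i

simplex : ∀ {n} → Subset n → Complex n
simplex S σ = σ ⊆ S

∂ : ∀ {n} → Subset n → Complex n
∂ S σ = σ ⊆ S × ¬ (S ⊆ σ)

deleteF : ∀ {n} → Complex n → Subset n → Complex n
deleteF K S σ = K σ × ¬ (S ⊆ σ)

lk : ∀ {n} → Complex n → Subset n → Complex n
lk K S G = K G × (G ∩ S ≡ ⊥) × K (G ∪ S)

join : ∀ {n} → Complex n → Complex n → Complex n
join A B σ = ∃₂ λ a b → A a × B b × σ ≡ a ∪ b

_∪K_ : ∀ {n} → Complex n → Complex n → Complex n
(A ∪K B) σ = A σ ⊎ B σ

stellar : ∀ {n} → Complex n → Subset n → Fin n → Complex n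
stellar K S v σ =
  (K S × (deleteF K S ∪K join (simplex ⁅ v ⁆) (join (∂ S) (lk K S))) σ)
  ⊎ (¬ K S × K σ)

diamond : (d : ℕ) → Complex (N d) → Complex (N d)
diamond d K = foldl (λ L i → stellar L (F d i) (vNew d i)) K (allFin (suc d))

image : ∀ {n} → Permutation′ n → Subset n → Subset n
image π σ = tabulate (λ y → lookup σ (π ⟨$⟩ˡ y))

_≅_ : ∀ {n} → Complex n → Complex n → Set
_≅_ {n} K L = Σ (Permutation′ n) λ π → ∀ σ → (K σ → L (image π σ)) × (L (image π σ) → K σ)

-- Write DiamondFace i j for the set of faces σ that avoid the vertex i, contain a new vertex v_m
-- only for i ≤ m < j, contain no antipodal pair {m, v_m} of the cross-polytope with m > i, and,
-- when i < j, do not contain all of {j, …, d+1} = F_{j-1}.  Γ_i is DiamondFace i 0, and the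
-- stellar subdivision at F_j turns DiamondFace i j into DiamondFace i (j+1): for j < i it does
-- nothing, since i ∈ F_j; otherwise the cone from v_j over ∂F_j * lk(F_j) supplies exactly the
-- faces that contain v_j.  So ◇(Γ_i) = DiamondFace i (d+1).  Exchanging k and v_k then sends a
-- face σ of ◇(Γ_k) into ◇(Γ_i), where i is the least m > k with v_m ∈ σ (or d+1 if there is
-- none), and sends every ◇(Γ_i) with i > k back into ◇(Γ_k).
module Submission where

open import Defs
open import Level using (Level)
open import Function using (id; _∘_; Equivalence)
open import Data.Nat as ℕ using (ℕ; zero; suc; _≤_; _<_; s≤s)
import Data.Nat.Properties as ℕ
open import Data.Bool using (Bool; true; not)
open import Data.Bool.Properties using (T-≡; ¬-not; not-¬)
open import Data.Fin as Fin using (Fin; toℕ; inject₁; fromℕ; fromℕ<; splitAt; _↑ˡ_; _↑ʳ_)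
import Data.Fin.Properties as Fin
open import Data.Fin.Subset using (Subset; _∈_; _∉_; _⊆_; _∪_; _∩_; ∁; ⁅_⁆; ⊥)
import Data.Fin.Subset.Properties as Subset
open import Data.Fin.Permutation using (Permutation′; _⟨$⟩ˡ_; transpose)
import Data.Fin.Permutation.Components as PC
import Data.Vec as Vec
import Data.Vec.Properties as Vec
open import Data.List using (foldl; tabulate)
open import Data.Sum using (_⊎_; inj₁; inj₂; [_,_])
open import Data.Product using (Σ; ∃; _×_; _,_; proj₁; proj₂; map₂)
open import Relation.Nullary using (¬_; ¬?; Dec; yes; no; contradiction; _×-dec_)
open import Relation.Nullary.Decidable using (dec-true; dec-false; decidable-stable)
open import Relation.Unary using (_⊆′_; _≐′_)
open import Relation.Unary.Properties using (≐′-sym; ≐′-trans)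
open import Relation.Binary.PropositionalEquality hiding ([_])
open import Relation.Binary using (tri<; tri≈; tri>)

private
  variable
    a b ℓ : Level
    n : ℕ

foldl-tabulate-invariant : {A : Set a} {X : Set b} (R : ℕ → X → Set ℓ) (f : X → A → X)
  (g : Fin n → A) {x : X} → R 0 x →
  (∀ i {y} → R (toℕ i) y → R (suc (toℕ i)) (f y (g i))) →
  R n (foldl f x (tabulate g))
foldl-tabulate-invariant {n = zero}  R f g r₀ step = r₀
foldl-tabulate-invariant {n = suc n} R f g r₀ step =
  foldl-tabulate-invariant (R ∘ suc) f (g ∘ Fin.suc) (step Fin.zero r₀) (step ∘ Fin.suc)

module _ {n} (S : Subset n) (v : Fin n) where

  subdivided : Complex n → Complex n
  subdivided K = deleteF K S ∪K join (simplex ⁅ v ⁆) (join (∂ S) (lk K S))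

  stellar-present : ∀ {K} → K S → stellar K S v ≐′ subdivided K
  stellar-present K∋S = (λ { σ (inj₁ (_ , σ∈)) → σ∈ ; σ (inj₂ (K∌S , _)) → contradiction K∋S K∌S })
                      , (λ σ σ∈ → inj₁ (K∋S , σ∈))

  stellar-absent : ∀ {K} → ¬ K S → stellar K S v ≐′ K
  stellar-absent K∌S = (λ { σ (inj₁ (K∋S , _)) → contradiction K∋S K∌S ; σ (inj₂ (_ , K∋σ)) → K∋σ })
                     , (λ σ K∋σ → inj₂ (K∌S , K∋σ))

  stellar-resp-≐′ : ∀ {K L} → K ≐′ L → stellar K S v ≐′ stellar L S v
  stellar-resp-≐′ K≐L = transport K≐L , transport (≐′-sym K≐L)
    where
    transport : ∀ {K L} → K ≐′ L → stellar K S v ⊆′ stellar L S v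
    transport (K⊆L , L⊆K) σ (inj₂ (K∌S , K∋σ)) = inj₂ (K∌S ∘ L⊆K S , K⊆L σ K∋σ)
    transport (K⊆L , L⊆K) σ (inj₁ (K∋S , inj₁ (K∋σ , S⊈σ))) = inj₁ (K⊆L S K∋S , inj₁ (K⊆L σ K∋σ , S⊈σ))
    transport (K⊆L , L⊆K) σ (inj₁ (K∋S , inj₂ (p , q , p∈ , (r , c , r∈ , (K∋c , c∩S , K∋c∪S) , q≡) , σ≡))) =
      inj₁ (K⊆L S K∋S , inj₂ (p , q , p∈ , (r , c , r∈ , (K⊆L c K∋c , c∩S , K⊆L _ K∋c∪S) , q≡) , σ≡))

∈-tabulate⁺ : {f : Fin n → Bool} {y : Fin n} → f y ≡ true → y ∈ Vec.tabulate f
∈-tabulate⁺ {f = f} {y} fy = Vec.lookup⇒[]= y _ (trans (Vec.lookup∘tabulate f y) fy)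

∈-tabulate⁻ : {f : Fin n → Bool} {y : Fin n} → y ∈ Vec.tabulate f → f y ≡ true
∈-tabulate⁻ {f = f} {y} y∈ = trans (sym (Vec.lookup∘tabulate f y)) (Vec.[]=⇒lookup y∈)

∈-image⁺ : (π : Permutation′ n) {σ : Subset n} {y : Fin n} → π ⟨$⟩ˡ y ∈ σ → y ∈ image π σ
∈-image⁺ π π⁻¹y∈σ = ∈-tabulate⁺ (Vec.[]=⇒lookup π⁻¹y∈σ)

∈-image⁻ : (π : Permutation′ n) {σ : Subset n} {y : Fin n} → y ∈ image π σ → π ⟨$⟩ˡ y ∈ σ
∈-image⁻ π {σ} y∈ = Vec.lookup⇒[]= _ σ (∈-tabulate⁻ y∈)

least-witness : {P : Fin n → Set ℓ} → (∀ m → Dec (P m)) → ∃ P →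
                ∃ λ m → P m × (∀ m′ → toℕ m′ < toℕ m → ¬ P m′)
least-witness {n = n} {P = P} P? (m , Pm)
  with Fin.¬∀⟶∃¬-smallest n (¬_ ∘ P) (¬? ∘ P?) (λ ∀¬P → ∀¬P m Pm)
... | m₀ , ¬¬Pm₀ , below = m₀ , decidable-stable (P? m₀) ¬¬Pm₀ , λ m′ m′<m₀ →
  subst (¬_ ∘ P) (Fin.toℕ-injective (trans (Fin.toℕ-inject (fromℕ< m′<m₀)) (Fin.toℕ-fromℕ< m′<m₀)))
    (below (fromℕ< m′<m₀))

transpose-at-left : (a b : Fin n) → PC.transpose a b a ≡ b
transpose-at-left a b rewrite dec-true (a Fin.≟ a) refl = refl

transpose-elsewhere : (a b : Fin n) {y : Fin n} → y ≢ a → y ≢ b → PC.transpose a b y ≡ y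
transpose-elsewhere a b {y} y≢a y≢b rewrite dec-false (y Fin.≟ a) y≢a | dec-false (y Fin.≟ b) y≢b = refl

toℕ-inject₁-≮ : (x : Fin n) → ¬ toℕ x < toℕ (inject₁ x)
toℕ-inject₁-≮ x = ℕ.<-irrefl (sym (Fin.toℕ-inject₁ x))

module _ {σ S : Subset n} {v : Fin n} where

  ∈-∩∁⁺ : ∀ {y} → y ∈ σ → y ∉ S → y ≢ v → y ∈ σ ∩ ∁ (S ∪ ⁅ v ⁆)
  ∈-∩∁⁺ y∈σ y∉S y≢v = Subset.x∈p∩q⁺ (y∈σ , Subset.x∉p⇒x∈∁p
    ([ y∉S , y≢v ∘ Subset.x∈⁅y⁆⇒x≡y v ] ∘ Subset.x∈p∪q⁻ S ⁅ v ⁆))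

  ∈-∩∁⁻ : ∀ {y} → y ∈ σ ∩ ∁ (S ∪ ⁅ v ⁆) → y ∈ σ × y ∉ S × y ≢ v
  ∈-∩∁⁻ y∈ with Subset.x∈p∩q⁻ σ _ y∈
  ... | y∈σ , y∈∁ = y∈σ , y∉S∪v ∘ Subset.x∈p∪q⁺ ∘ inj₁
                  , λ { refl → y∉S∪v (Subset.x∈p∪q⁺ (inj₂ (Subset.x∈⁅x⁆ v))) }
    where y∉S∪v = Subset.x∈∁p⇒x∉p y∈∁

  split-at-vertex : v ∈ σ → σ ≡ ⁅ v ⁆ ∪ ((σ ∩ S) ∪ (σ ∩ ∁ (S ∪ ⁅ v ⁆)))
  split-at-vertex v∈σ = Subset.⊆-antisym into onto
    where
    into : σ ⊆ ⁅ v ⁆ ∪ ((σ ∩ S) ∪ (σ ∩ ∁ (S ∪ ⁅ v ⁆)))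
    into {y} y∈σ with y Fin.≟ v | y Subset.∈? S
    ... | yes refl | _      = Subset.x∈p∪q⁺ (inj₁ (Subset.x∈⁅x⁆ v))
    ... | no y≢v   | yes y∈S = Subset.x∈p∪q⁺ (inj₂ (Subset.x∈p∪q⁺ (inj₁ (Subset.x∈p∩q⁺ (y∈σ , y∈S)))))
    ... | no y≢v   | no y∉S  = Subset.x∈p∪q⁺ (inj₂ (Subset.x∈p∪q⁺ (inj₂ (∈-∩∁⁺ y∈σ y∉S y≢v))))
    onto : ⁅ v ⁆ ∪ ((σ ∩ S) ∪ (σ ∩ ∁ (S ∪ ⁅ v ⁆))) ⊆ σ
    onto y∈ with Subset.x∈p∪q⁻ ⁅ v ⁆ _ y∈
    ... | inj₁ y∈v = subst (_∈ σ) (sym (Subset.x∈⁅y⁆⇒x≡y v y∈v)) v∈σ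
    ... | inj₂ y∈b∪c with Subset.x∈p∪q⁻ (σ ∩ S) _ y∈b∪c
    ...   | inj₁ y∈b = proj₁ (Subset.x∈p∩q⁻ σ S y∈b)
    ...   | inj₂ y∈c = proj₁ (∈-∩∁⁻ y∈c)

module _ (d : ℕ) where

  vOrig : Fin (suc (suc d)) → Fin (N d)
  vOrig m = m ↑ˡ suc d

  vOrig-injective : ∀ {m m′} → vOrig m ≡ vOrig m′ → m ≡ m′
  vOrig-injective = Fin.↑ˡ-injective (suc d) _ _

  vNew-injective : ∀ {m m′} → vNew d m ≡ vNew d m′ → m ≡ m′
  vNew-injective = Fin.↑ʳ-injective (suc (suc d)) _ _

  vOrig≢vNew : ∀ m m′ → vOrig m ≢ vNew d m′
  vOrig≢vNew m m′ eq
    with () ← trans (sym (Fin.splitAt-↑ˡ _ m _)) (trans (cong (splitAt _) eq) (Fin.splitAt-↑ʳ _ _ m′))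

  data VertexView : Fin (N d) → Set where
    orig : ∀ m → VertexView (vOrig m)
    new  : ∀ m → VertexView (vNew d m)

  vertexView : ∀ y → VertexView y
  vertexView y with splitAt (suc (suc d)) y in eq
  ... | inj₁ m = subst VertexView (Fin.splitAt⁻¹-↑ˡ eq) (orig m)
  ... | inj₂ m = subst VertexView (Fin.splitAt⁻¹-↑ʳ eq) (new m)

  ⊆-byVertices : {p q : Subset (N d)} → (∀ m → vOrig m ∈ p → vOrig m ∈ q) →
                 (∀ m → vNew d m ∈ p → vNew d m ∈ q) → p ⊆ q
  ⊆-byVertices {p} {q} origs news {y} = by (vertexView y)
    where
    by : ∀ {y} → VertexView y → y ∈ p → y ∈ q
    by (orig m) = origs m
    by (new m)  = news m

  -- F d x and Γset d i are both of the form Vec.tabulate (byPart g h).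
  byPart : (Fin (suc (suc d)) → Bool) → (Fin (suc d) → Bool) → Fin (N d) → Bool
  byPart g h y = [ g , h ] (splitAt (suc (suc d)) y)

  module _ {g : Fin (suc (suc d)) → Bool} {h : Fin (suc d) → Bool} where

    vOrig∈byPart⁺ : ∀ {m} → g m ≡ true → vOrig m ∈ Vec.tabulate (byPart g h)
    vOrig∈byPart⁺ {m} gm = ∈-tabulate⁺ {f = byPart g h} (trans (cong [ g , h ] (Fin.splitAt-↑ˡ _ m _)) gm)

    vOrig∈byPart⁻ : ∀ {m} → vOrig m ∈ Vec.tabulate (byPart g h) → g m ≡ true
    vOrig∈byPart⁻ {m} m∈ = trans (sym (cong [ g , h ] (Fin.splitAt-↑ˡ _ m _))) (∈-tabulate⁻ {f = byPart g h} m∈)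

    vNew∈byPart⁻ : ∀ {m} → vNew d m ∈ Vec.tabulate (byPart g h) → h m ≡ true
    vNew∈byPart⁻ {m} m∈ = trans (sym (cong [ g , h ] (Fin.splitAt-↑ʳ _ _ m))) (∈-tabulate⁻ {f = byPart g h} m∈)

  vOrig∈F⁺ : ∀ {x m} → toℕ x < toℕ m → vOrig m ∈ F d x
  vOrig∈F⁺ x<m = vOrig∈byPart⁺ (Equivalence.to T-≡ (ℕ.<⇒<ᵇ x<m))

  vOrig∈F⁻ : ∀ {x m} → vOrig m ∈ F d x → toℕ x < toℕ m
  vOrig∈F⁻ m∈ = ℕ.<ᵇ⇒< _ _ (Equivalence.from T-≡ (vOrig∈byPart⁻ m∈))

  vNew∉F : ∀ {x m} → vNew d m ∉ F d x
  vNew∉F m∈ with () ← vNew∈byPart⁻ m∈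

  vOrig∈Γset⁺ : ∀ {i m} → toℕ m ≢ toℕ i → vOrig m ∈ Γset d i
  vOrig∈Γset⁺ m≢i = vOrig∈byPart⁺ (cong not (¬-not (m≢i ∘ ℕ.≡ᵇ⇒≡ _ _ ∘ Equivalence.from T-≡)))

  vOrig∈Γset⁻ : ∀ {i m} → vOrig m ∈ Γset d i → toℕ m ≢ toℕ i
  vOrig∈Γset⁻ m∈ m≡i = not-¬ (sym (Equivalence.to T-≡ (ℕ.≡⇒≡ᵇ _ _ m≡i))) (sym (vOrig∈byPart⁻ m∈))

  vNew∉Γset : ∀ {i m} → vNew d m ∉ Γset d i
  vNew∉Γset m∈ with () ← vNew∈byPart⁻ m∈

  record DiamondFace (i : Fin (suc (suc d))) (j : ℕ) (σ : Subset (N d)) : Set where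
    field
      avoids      : vOrig i ∉ σ
      new-range   : ∀ m → vNew d m ∈ σ → toℕ i ≤ toℕ m × toℕ m < j
      no-antipode : ∀ m → toℕ i < toℕ m → vOrig (inject₁ m) ∈ σ → vNew d m ∉ σ
      tail-absent : toℕ i < j → ¬ (∀ m → j ≤ toℕ m → vOrig m ∈ σ)
  open DiamondFace

  DiamondFace-mono : ∀ {i j σ τ} → τ ⊆ σ → DiamondFace i j σ → DiamondFace i j τ
  DiamondFace-mono τ⊆σ f = record
    { avoids      = avoids f ∘ τ⊆σ
    ; new-range   = λ m → new-range f m ∘ τ⊆σ
    ; no-antipode = λ m i<m m∈τ → no-antipode f m i<m (τ⊆σ m∈τ) ∘ τ⊆σ
    ; tail-absent = λ i<j tail⊆τ → tail-absent f i<j (λ m j≤m → τ⊆σ (tail⊆τ m j≤m))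
    }

  DiamondFace-frozen : ∀ {i j j′ σ} → j ≤ toℕ i → j′ ≤ toℕ i → DiamondFace i j σ → DiamondFace i j′ σ
  DiamondFace-frozen j≤i j′≤i f = record
    { avoids      = avoids f
    ; new-range   = λ m m∈σ → let i≤m , m<j = new-range f m m∈σ in
                      contradiction (ℕ.≤-trans j≤i i≤m) (ℕ.<⇒≱ m<j)
    ; no-antipode = no-antipode f
    ; tail-absent = λ i<j′ → contradiction j′≤i (ℕ.<⇒≱ i<j′)
    }

  Γ≐DiamondFace₀ : ∀ i → Γ d i ≐′ DiamondFace i 0
  Γ≐DiamondFace₀ i = into , onto
    where
    into : Γ d i ⊆′ DiamondFace i 0
    into σ σ⊆Γ = record
      { avoids      = λ i∈σ → vOrig∈Γset⁻ (σ⊆Γ i∈σ) refl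
      ; new-range   = λ m m∈σ → contradiction (σ⊆Γ m∈σ) vNew∉Γset
      ; no-antipode = λ m _ _ m∈σ → vNew∉Γset (σ⊆Γ m∈σ)
      ; tail-absent = λ ()
      }
    onto : DiamondFace i 0 ⊆′ Γ d i
    onto σ f = ⊆-byVertices
      (λ m m∈σ → vOrig∈Γset⁺ λ m≡i → avoids f (subst (λ z → vOrig z ∈ σ) (Fin.toℕ-injective m≡i) m∈σ))
      (λ m m∈σ → contradiction (proj₂ (new-range f m m∈σ)) ℕ.n≮0)

  F⊆⁺ : ∀ {x σ} → (∀ m → toℕ x < toℕ m → vOrig m ∈ σ) → F d x ⊆ σ
  F⊆⁺ tail⊆σ = ⊆-byVertices (λ m m∈F → tail⊆σ m (vOrig∈F⁻ m∈F)) (λ m m∈F → contradiction m∈F vNew∉F)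

  F⊆⁻ : ∀ {x σ} → F d x ⊆ σ → ∀ m → toℕ x < toℕ m → vOrig m ∈ σ
  F⊆⁻ F⊆σ m x<m = F⊆σ (vOrig∈F⁺ x<m)

  ∪F-tail : ∀ {x c} → vOrig (inject₁ x) ∈ c → ∀ m → toℕ x ≤ toℕ m → vOrig m ∈ c ∪ F d x
  ∪F-tail {x} {c} x∈c m x≤m with ℕ.m≤n⇒m<n∨m≡n x≤m
  ... | inj₁ x<m = Subset.x∈p∪q⁺ (inj₂ (vOrig∈F⁺ x<m))
  ... | inj₂ x≡m = Subset.x∈p∪q⁺ (inj₁ (subst (λ z → vOrig z ∈ c) x≡m′ x∈c))
    where x≡m′ = Fin.toℕ-injective (trans (Fin.toℕ-inject₁ x) x≡m)

  F∈DiamondFace : ∀ {i x} → toℕ i ≤ toℕ x → DiamondFace i (toℕ x) (F d x)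
  F∈DiamondFace {x = x} i≤x = record
    { avoids      = λ i∈F → ℕ.<⇒≱ (vOrig∈F⁻ i∈F) i≤x
    ; new-range   = λ m m∈F → contradiction m∈F vNew∉F
    ; no-antipode = λ m _ _ → vNew∉F
    ; tail-absent = λ _ tail⊆F →
        toℕ-inject₁-≮ x (vOrig∈F⁻ (tail⊆F (inject₁ x) (ℕ.≤-reflexive (sym (Fin.toℕ-inject₁ x)))))
    }

  module SubdivisionStep {i : Fin (suc (suc d))} {x : Fin (suc d)} (i≤x : toℕ i ≤ toℕ x) where

    K K′ : Complex (N d)
    K  = DiamondFace i (toℕ x)
    K′ = DiamondFace i (suc (toℕ x))

    deleted⊆ : deleteF K (F d x) ⊆′ K′
    deleted⊆ σ (f , F⊈σ) = record
      { avoids      = avoids f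
      ; new-range   = λ m m∈σ → map₂ ℕ.m<n⇒m<1+n (new-range f m m∈σ)
      ; no-antipode = no-antipode f
      ; tail-absent = λ _ → F⊈σ ∘ F⊆⁺
      }

    cone⊆ : join (simplex ⁅ vNew d x ⁆) (join (∂ (F d x)) (lk K (F d x))) ⊆′ K′
    cone⊆ σ (p , q , p⊆v , (b , c , (b⊆F , F⊈b) , (c∈K , c∩F≡⊥ , c∪F∈K) , q≡b∪c) , σ≡p∪q) = record
      { avoids      = avoids′
      ; new-range   = new-range′
      ; no-antipode = no-antipode′
      ; tail-absent = λ _ tail⊆σ → F⊈b (F⊆⁺ λ m x<m → tail-in-b (tail⊆σ m x<m) x<m)
      }
      where
      vertex-cases : ∀ {y} → y ∈ σ → y ≡ vNew d x ⊎ y ∈ b ⊎ y ∈ c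
      vertex-cases y∈σ with Subset.x∈p∪q⁻ p q (subst (_ ∈_) σ≡p∪q y∈σ)
      ... | inj₁ y∈p = inj₁ (Subset.x∈⁅y⁆⇒x≡y _ (p⊆v y∈p))
      ... | inj₂ y∈q = inj₂ (Subset.x∈p∪q⁻ b c (subst (_ ∈_) q≡b∪c y∈q))

      orig-cases : ∀ {m} → vOrig m ∈ σ → toℕ x < toℕ m ⊎ vOrig m ∈ c
      orig-cases m∈σ with vertex-cases m∈σ
      ... | inj₁ m≡v        = contradiction m≡v (vOrig≢vNew _ _)
      ... | inj₂ (inj₁ m∈b) = inj₁ (vOrig∈F⁻ (b⊆F m∈b))
      ... | inj₂ (inj₂ m∈c) = inj₂ m∈c

      new-cases : ∀ {m} → vNew d m ∈ σ → m ≡ x ⊎ vNew d m ∈ c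
      new-cases m∈σ with vertex-cases m∈σ
      ... | inj₁ m≡v        = inj₁ (vNew-injective m≡v)
      ... | inj₂ (inj₁ m∈b) = contradiction (b⊆F m∈b) vNew∉F
      ... | inj₂ (inj₂ m∈c) = inj₂ m∈c

      tail-in-b : ∀ {m} → vOrig m ∈ σ → toℕ x < toℕ m → vOrig m ∈ b
      tail-in-b m∈σ x<m with vertex-cases m∈σ
      ... | inj₁ m≡v        = contradiction m≡v (vOrig≢vNew _ _)
      ... | inj₂ (inj₁ m∈b) = m∈b
      ... | inj₂ (inj₂ m∈c) = contradiction (subst (_ ∈_) c∩F≡⊥ (Subset.x∈p∩q⁺ (m∈c , vOrig∈F⁺ x<m))) Subset.∉⊥

      avoids′ : vOrig i ∉ σ
      avoids′ i∈σ with orig-cases i∈σ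
      ... | inj₁ x<i = ℕ.<⇒≱ x<i i≤x
      ... | inj₂ i∈c = avoids c∈K i∈c

      new-range′ : ∀ m → vNew d m ∈ σ → toℕ i ≤ toℕ m × toℕ m < suc (toℕ x)
      new-range′ m m∈σ with new-cases m∈σ
      ... | inj₁ refl = i≤x , ℕ.n<1+n (toℕ x)
      ... | inj₂ m∈c  = map₂ ℕ.m<n⇒m<1+n (new-range c∈K m m∈c)

      -- For m = x the antipodal pair {x, v_x} would put all of {x, …, d+1} into c ∪ F_x.
      no-antipode′ : ∀ m → toℕ i < toℕ m → vOrig (inject₁ m) ∈ σ → vNew d m ∉ σ
      no-antipode′ m i<m m∈σ m′∈σ with new-cases m′∈σ | orig-cases m∈σ
      ... | inj₁ refl | inj₁ x<x = toℕ-inject₁-≮ x x<x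
      ... | inj₁ refl | inj₂ x∈c = tail-absent c∪F∈K i<m (∪F-tail x∈c)
      ... | inj₂ m′∈c | inj₁ x<m =
        ℕ.<-asym (proj₂ (new-range c∈K m m′∈c)) (subst (toℕ x <_) (Fin.toℕ-inject₁ m) x<m)
      ... | inj₂ m′∈c | inj₂ m∈c = no-antipode c∈K m i<m m∈c m′∈c

    new-below : ∀ {σ m} → K′ σ → vNew d m ∈ σ → m ≢ x → toℕ i ≤ toℕ m × toℕ m < toℕ x
    new-below f m∈σ m≢x with new-range f _ m∈σ
    ... | i≤m , m≤x = i≤m , ℕ.≤∧≢⇒< (ℕ.≤-pred m≤x) (m≢x ∘ Fin.toℕ-injective)

    unsubdivided : ∀ {σ} → K′ σ → vNew d x ∉ σ → K σ
    unsubdivided {σ} f x∉σ = record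
      { avoids      = avoids f
      ; new-range   = λ m m∈σ → new-below f m∈σ λ { refl → x∉σ m∈σ }
      ; no-antipode = no-antipode f
      ; tail-absent = λ i<x tail⊆σ → tail-absent f (ℕ.m<n⇒m<1+n i<x) (λ m x<m → tail⊆σ m (ℕ.<⇒≤ x<m))
      }

    module Link {σ} (f : K′ σ) (x∈σ : vNew d x ∈ σ) where

      c : Subset (N d)
      c = σ ∩ ∁ (F d x ∪ ⁅ vNew d x ⁆)

      ∈c⁻ : ∀ {y} → y ∈ c → y ∈ σ × y ∉ F d x × y ≢ vNew d x
      ∈c⁻ = ∈-∩∁⁻

      ∈c∪F⁻ : ∀ {y} → y ∈ c ∪ F d x → (y ∈ σ × y ≢ vNew d x) ⊎ y ∈ F d x
      ∈c∪F⁻ y∈ with Subset.x∈p∪q⁻ c (F d x) y∈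
      ... | inj₁ y∈c = inj₁ (proj₁ (∈c⁻ y∈c) , proj₂ (proj₂ (∈c⁻ y∈c)))
      ... | inj₂ y∈F = inj₂ y∈F

      vNew∈c∪F⁻ : ∀ {m} → vNew d m ∈ c ∪ F d x → vNew d m ∈ σ × m ≢ x
      vNew∈c∪F⁻ m∈ with ∈c∪F⁻ m∈
      ... | inj₁ (m∈σ , m≢x) = m∈σ , m≢x ∘ cong (vNew d)
      ... | inj₂ m∈F         = contradiction m∈F vNew∉F

      c∪F∈K : K (c ∪ F d x)
      c∪F∈K = record
        { avoids      = λ i∈ → [ avoids f ∘ proj₁ , (λ i∈F → ℕ.<⇒≱ (vOrig∈F⁻ i∈F) i≤x) ] (∈c∪F⁻ i∈)
        ; new-range   = λ m m∈ → let m∈σ , m≢x = vNew∈c∪F⁻ m∈ in new-below f m∈σ m≢x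
        ; no-antipode = no-antipode′
        ; tail-absent = λ i<x tail⊆ → no-antipode f x i<x
                          (orig-x-in-σ (tail⊆ (inject₁ x) (ℕ.≤-reflexive (sym (Fin.toℕ-inject₁ x))))) x∈σ
        }
        where
        orig-x-in-σ : vOrig (inject₁ x) ∈ c ∪ F d x → vOrig (inject₁ x) ∈ σ
        orig-x-in-σ x∈ with ∈c∪F⁻ x∈
        ... | inj₁ (x∈σ′ , _) = x∈σ′
        ... | inj₂ x∈F        = contradiction (vOrig∈F⁻ x∈F) (toℕ-inject₁-≮ x)
        no-antipode′ : ∀ m → toℕ i < toℕ m → vOrig (inject₁ m) ∈ c ∪ F d x → vNew d m ∉ c ∪ F d x
        no-antipode′ m i<m m∈ m′∈ with vNew∈c∪F⁻ m′∈ | ∈c∪F⁻ m∈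
        ... | m′∈σ , _   | inj₁ (m∈σ , _) = no-antipode f m i<m m∈σ m′∈σ
        ... | m′∈σ , m≢x | inj₂ m∈F       =
          ℕ.<-asym (proj₂ (new-below f m′∈σ m≢x)) (subst (toℕ x <_) (Fin.toℕ-inject₁ m) (vOrig∈F⁻ m∈F))

      c∩F≡⊥ : c ∩ F d x ≡ ⊥
      c∩F≡⊥ = Subset.Empty-unique λ (y , y∈) → let y∈c , y∈F = Subset.x∈p∩q⁻ c (F d x) y∈ in
        proj₁ (proj₂ (∈c⁻ y∈c)) y∈F

      F⊈σ∩F : ¬ F d x ⊆ σ ∩ F d x
      F⊈σ∩F F⊆ = tail-absent f (s≤s i≤x) (F⊆⁻ (Subset.p∩q⊆p σ (F d x) ∘ F⊆))

      cone : join (simplex ⁅ vNew d x ⁆) (join (∂ (F d x)) (lk K (F d x))) σ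
      cone = ⁅ vNew d x ⁆ , (σ ∩ F d x) ∪ c , Subset.⊆-refl
           , (σ ∩ F d x , c , (Subset.p∩q⊆q σ (F d x) , F⊈σ∩F)
             , (DiamondFace-mono (Subset.p⊆p∪q (F d x)) c∪F∈K , c∩F≡⊥ , c∪F∈K) , refl)
           , split-at-vertex x∈σ

    ⊆subdivided : K′ ⊆′ subdivided (F d x) (vNew d x) K
    ⊆subdivided σ f with vNew d x Subset.∈? σ
    ... | no x∉σ  = inj₁ (unsubdivided f x∉σ , tail-absent f (s≤s i≤x) ∘ F⊆⁻)
    ... | yes x∈σ = inj₂ (Link.cone f x∈σ)

    subdivided≐ : subdivided (F d x) (vNew d x) K ≐′ K′
    subdivided≐ = (λ σ → [ deleted⊆ σ , cone⊆ σ ]) , ⊆subdivided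

  stellar-DiamondFace : ∀ i x →
    stellar (DiamondFace i (toℕ x)) (F d x) (vNew d x) ≐′ DiamondFace i (suc (toℕ x))
  stellar-DiamondFace i x with toℕ i ℕ.≤? toℕ x
  ... | yes i≤x = ≐′-trans (stellar-present (F d x) (vNew d x) (F∈DiamondFace i≤x))
                    (SubdivisionStep.subdivided≐ i≤x)
  ... | no i≰x  = ≐′-trans (stellar-absent (F d x) (vNew d x) λ f → avoids f (vOrig∈F⁺ x<i))
                    ((λ σ → DiamondFace-frozen (ℕ.<⇒≤ x<i) x<i) , (λ σ → DiamondFace-frozen x<i (ℕ.<⇒≤ x<i)))
    where x<i = ℕ.≰⇒> i≰x

  diamond≐DiamondFace : ∀ i → diamond d (Γ d i) ≐′ DiamondFace i (suc d)
  diamond≐DiamondFace i =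
    foldl-tabulate-invariant (λ j L → L ≐′ DiamondFace i j) (λ L y → stellar L (F d y) (vNew d y)) id
      (Γ≐DiamondFace₀ i) (λ x L≐ → ≐′-trans (stellar-resp-≐′ (F d x) (vNew d x) L≐) (stellar-DiamondFace i x))

  last : Fin (suc (suc d))
  last = fromℕ (suc d)

  ≡last : ∀ m → suc d ≤ toℕ m → m ≡ last
  ≡last m d<m =
    Fin.toℕ-injective (trans (ℕ.≤-antisym (ℕ.≤-pred (Fin.toℕ<n m)) d<m) (sym (Fin.toℕ-fromℕ (suc d))))

  last∉⇒tail-absent : ∀ {σ} → vOrig last ∉ σ → ¬ (∀ m → suc d ≤ toℕ m → vOrig m ∈ σ)
  last∉⇒tail-absent last∉σ tail⊆σ = last∉σ (tail⊆σ last (ℕ.≤-reflexive (sym (Fin.toℕ-fromℕ (suc d)))))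

  last∉DiamondFace : ∀ {i σ} → DiamondFace i (suc d) σ → vOrig last ∉ σ
  last∉DiamondFace {i} {σ} f last∈σ with toℕ i ℕ.<? suc d
  ... | yes i<d+1 = tail-absent f i<d+1 λ m d<m → subst (λ z → vOrig z ∈ σ) (sym (≡last m d<m)) last∈σ
  ... | no i≮d+1  = avoids f (subst (λ z → vOrig z ∈ σ) (sym (≡last i (ℕ.≮⇒≥ i≮d+1))) last∈σ)

  module Swap (k : Fin (suc (suc d))) (k≤d : toℕ k ≤ d) where

    k′ : Fin (suc d)
    k′ = fromℕ< (s≤s k≤d)

    swap : Permutation′ (N d)
    swap = transpose (vOrig k) (vNew d k′)

    vOrig≢k : ∀ {m} → toℕ m ≢ toℕ k → vOrig m ≢ vOrig k
    vOrig≢k m≢k = m≢k ∘ cong toℕ ∘ vOrig-injective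

    vNew≢k′ : ∀ {m} → toℕ m ≢ toℕ k → vNew d m ≢ vNew d k′
    vNew≢k′ m≢k eq = m≢k (trans (cong toℕ (vNew-injective eq)) (Fin.toℕ-fromℕ< (s≤s k≤d)))

    swap-fixes : ∀ {y} → y ≢ vOrig k → y ≢ vNew d k′ → swap ⟨$⟩ˡ y ≡ y
    swap-fixes y≢k y≢k′ = transpose-elsewhere (vNew d k′) (vOrig k) y≢k′ y≢k

    module _ {σ : Subset (N d)} where

      vOrig∈swap⁺ : ∀ {m} → toℕ m ≢ toℕ k → vOrig m ∈ σ → vOrig m ∈ image swap σ
      vOrig∈swap⁺ m≢k m∈σ = ∈-image⁺ swap (subst (_∈ σ) (sym (swap-fixes (vOrig≢k m≢k) (vOrig≢vNew _ _))) m∈σ)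

      vOrig∈swap⁻ : ∀ {m} → toℕ m ≢ toℕ k → vOrig m ∈ image swap σ → vOrig m ∈ σ
      vOrig∈swap⁻ m≢k m∈ = subst (_∈ σ) (swap-fixes (vOrig≢k m≢k) (vOrig≢vNew _ _)) (∈-image⁻ swap m∈)

      vNew∈swap⁺ : ∀ {m} → toℕ m ≢ toℕ k → vNew d m ∈ σ → vNew d m ∈ image swap σ
      vNew∈swap⁺ m≢k m∈σ = ∈-image⁺ swap (subst (_∈ σ) (sym (swap-fixes (vOrig≢vNew _ _ ∘ sym) (vNew≢k′ m≢k))) m∈σ)

      vNew∈swap⁻ : ∀ {m} → toℕ m ≢ toℕ k → vNew d m ∈ image swap σ → vNew d m ∈ σ
      vNew∈swap⁻ m≢k m∈ = subst (_∈ σ) (swap-fixes (vOrig≢vNew _ _ ∘ sym) (vNew≢k′ m≢k)) (∈-image⁻ swap m∈)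

      vNew-k′∈swap⁺ : vOrig k ∈ σ → vNew d k′ ∈ image swap σ
      vNew-k′∈swap⁺ k∈σ = ∈-image⁺ swap (subst (_∈ σ) (sym (transpose-at-left (vNew d k′) (vOrig k))) k∈σ)

      vNew-k′∈swap⁻ : vNew d k′ ∈ image swap σ → vOrig k ∈ σ
      vNew-k′∈swap⁻ k′∈ = subst (_∈ σ) (transpose-at-left (vNew d k′) (vOrig k)) (∈-image⁻ swap k′∈)

    k<last : toℕ k < toℕ last
    k<last = subst (toℕ k <_) (sym (Fin.toℕ-fromℕ (suc d))) (s≤s k≤d)

    inject₁-above-k : ∀ {m : Fin (suc d)} → toℕ k < toℕ m → toℕ k < toℕ (inject₁ m)
    inject₁-above-k {m} = subst (toℕ k <_) (sym (Fin.toℕ-inject₁ m))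

    swap-face : ∀ {σ} i → toℕ k < toℕ i → vOrig i ∉ σ →
                (∀ m → toℕ k < toℕ m → vNew d m ∈ σ → toℕ i ≤ toℕ m) →
                DiamondFace k (suc d) σ → DiamondFace i (suc d) (image swap σ)
    swap-face {σ} i k<i i∉σ below f = record
      { avoids      = i∉σ ∘ vOrig∈swap⁻ (ℕ.>⇒≢ k<i)
      ; new-range   = new-range′
      ; no-antipode = λ m i<m m∈ m′∈ → let k<m = ℕ.<-trans k<i i<m in
          no-antipode f m k<m (vOrig∈swap⁻ (ℕ.>⇒≢ (inject₁-above-k k<m)) m∈) (vNew∈swap⁻ (ℕ.>⇒≢ k<m) m′∈)
      ; tail-absent = λ _ → last∉⇒tail-absent (last∉DiamondFace f ∘ vOrig∈swap⁻ (ℕ.>⇒≢ k<last))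
      }
      where
      new-range′ : ∀ m → vNew d m ∈ image swap σ → toℕ i ≤ toℕ m × toℕ m < suc d
      new-range′ m m∈ with toℕ m ℕ.≟ toℕ k
      ... | yes m≡k = contradiction (vNew-k′∈swap⁻ (subst (λ z → vNew d z ∈ image swap σ) m≡k′ m∈)) (avoids f)
        where m≡k′ = Fin.toℕ-injective (trans m≡k (sym (Fin.toℕ-fromℕ< (s≤s k≤d))))
      ... | no m≢k  = below m k<m m∈σ , Fin.toℕ<n m
        where
        m∈σ = vNew∈swap⁻ m≢k m∈
        k<m = ℕ.≤∧≢⇒< (proj₁ (new-range f m m∈σ)) (m≢k ∘ sym)

    new-above? : ∀ σ m → Dec (toℕ k < toℕ m × vNew d m ∈ σ)
    new-above? σ m = (toℕ k ℕ.<? toℕ m) ×-dec (vNew d m Subset.∈? σ)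

    swap-into : ∀ {σ} → DiamondFace k (suc d) σ →
                ∃ λ i → toℕ k < toℕ i × DiamondFace i (suc d) (image swap σ)
    swap-into {σ} f with Fin.any? (new-above? σ)
    ... | no none  = last , k<last , swap-face last k<last (last∉DiamondFace f)
                       (λ m k<m m∈σ → contradiction (m , k<m , m∈σ) none) f
    ... | yes some with least-witness (new-above? σ) some
    ...   | m , (k<m , m∈σ) , minimal = inject₁ m , inject₁-above-k k<m ,
              swap-face (inject₁ m) (inject₁-above-k k<m) (λ m∈ → no-antipode f m k<m m∈ m∈σ) below f
      where
      below : ∀ m′ → toℕ k < toℕ m′ → vNew d m′ ∈ σ → toℕ (inject₁ m) ≤ toℕ m′
      below m′ k<m′ m′∈σ =
        subst (_≤ toℕ m′) (sym (Fin.toℕ-inject₁ m)) (ℕ.≮⇒≥ λ m′<m → minimal m′ m′<m (k<m′ , m′∈σ))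

    swap-onto : ∀ {σ i} → toℕ k < toℕ i → DiamondFace i (suc d) (image swap σ) → DiamondFace k (suc d) σ
    swap-onto {σ} {i} k<i g = record
      { avoids      = λ k∈σ → ℕ.<⇒≱ k<i (subst (toℕ i ≤_) (Fin.toℕ-fromℕ< (s≤s k≤d))
                                  (proj₁ (new-range g k′ (vNew-k′∈swap⁺ k∈σ))))
      ; new-range   = new-range′
      ; no-antipode = no-antipode′
      ; tail-absent = λ _ → last∉⇒tail-absent (last∉DiamondFace g ∘ vOrig∈swap⁺ (ℕ.>⇒≢ k<last))
      }
      where
      new-range′ : ∀ m → vNew d m ∈ σ → toℕ k ≤ toℕ m × toℕ m < suc d
      new-range′ m m∈σ with toℕ m ℕ.≟ toℕ k
      ... | yes m≡k = ℕ.≤-reflexive (sym m≡k) , Fin.toℕ<n m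
      ... | no m≢k  = ℕ.<⇒≤ (ℕ.<-≤-trans k<i (proj₁ (new-range g m (vNew∈swap⁺ m≢k m∈σ)))) , Fin.toℕ<n m

      no-antipode′ : ∀ m → toℕ k < toℕ m → vOrig (inject₁ m) ∈ σ → vNew d m ∉ σ
      no-antipode′ m k<m m∈σ m′∈σ with ℕ.<-cmp (toℕ i) (toℕ m)
      ... | tri< i<m _ _ = no-antipode g m i<m m∈ρ (vNew∈swap⁺ (ℕ.>⇒≢ k<m) m′∈σ)
        where m∈ρ = vOrig∈swap⁺ (ℕ.>⇒≢ (inject₁-above-k k<m)) m∈σ
      ... | tri≈ _ i≡m _ = avoids g (subst (λ z → vOrig z ∈ image swap σ) m≡i m∈ρ)
        where
        m∈ρ = vOrig∈swap⁺ (ℕ.>⇒≢ (inject₁-above-k k<m)) m∈σ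
        m≡i = Fin.toℕ-injective (trans (Fin.toℕ-inject₁ m) (sym i≡m))
      ... | tri> _ _ m<i = ℕ.<⇒≱ m<i (proj₁ (new-range g m (vNew∈swap⁺ (ℕ.>⇒≢ k<m) m′∈σ)))

lemma4p1 : (d : ℕ) → (k : Fin (suc (suc d))) → toℕ k ≤ d →
    diamond d (Γ d k)
      ≅ (λ σ → Σ (Fin (suc (suc d))) λ i → (toℕ k < toℕ i) × diamond d (Γ d i) σ)
lemma4p1 d k k≤d = swap , λ σ →
    (λ σ∈◇Γk → let i , k<i , ρ∈ = swap-into (to◇ k σ∈◇Γk) in i , k<i , from◇ i ρ∈)
  , (λ (i , k<i , ρ∈◇Γi) → from◇ k (swap-onto k<i (to◇ i ρ∈◇Γi)))
  where
  open Swap d k k≤d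
  to◇ : ∀ i {σ} → diamond d (Γ d i) σ → DiamondFace d i (suc d) σ
  to◇ i = proj₁ (diamond≐DiamondFace d i) _
  from◇ : ∀ i {σ} → DiamondFace d i (suc d) σ → diamond d (Γ d i) σ
  from◇ i = proj₂ (diamond≐DiamondFace d i) _
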